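{- In the setting below, if $\rho_1\equiv\rho_2$ then $t_v(\rho_1)=t_v(\rho_2)$ for all $v\in V_0$.
   Context: $G=(V,E)$ is a finite strongly connected directed graph, $T\subseteq V$ a nonempty set of targets, $V_0=V\setminus T$, $d(v)$ the out-degree. At each $v\in V_0$ a rotor mechanism is fixed: an ordering $e_v^1,\dots,e_v^{d(v)}$ of the arcs leaving $v$, extended periodically; for $e=e_v^i$ put $e^+=e_v^{i+1}$. A rotor configuration is a map $\rho:V_0\to E$ with $\rho(v)$ an arc leaving $v$. A particle at $v\in V_0$ steps by replacing $\rho(v)$ with $\rho(v)^+$ and moving along the new $\rho(v)$; particles stop on reaching $T$. $t_v(\rho)\in T$ is the target at which a single particle started at $v$ with initial rotor configuration $\rho$ stops. A particle configuration is $\sigma:V_0\to\mathbb{N}$; $\sigma\rho$ is the rotor configuration obtained by placing $\sigma(v)$ particles at each $v$ and letting all step until each reaches $T$ (independent of order). $\rho\equiv\rho'$ means $\sigma\rho=\sigma\rho'$ for some particle configuration $\sigma$. -}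

module Defs where

open import Data.Nat using (ℕ; zero; suc; _+_; _%_)
open import Data.Nat.DivMod using (m%n<n)
open import Data.Fin using (Fin; toℕ; fromℕ<; _≟_)
open import Data.Bool using (Bool; true; false)
open import Data.Product using (Σ; _×_; _,_)
open import Relation.Nullary using (yes; no)
open import Relation.Binary.PropositionalEquality using (_≡_; subst; sym)

cyc : ∀ {d} → Fin d → Fin d
cyc {suc k} i = fromℕ< (m%n<n (suc (toℕ i)) (suc k))

-- A finite directed multigraph on vertex set Fin n:
--   d v            = out-degree of v,
--   hd v i         = head of the i-th arc leaving v (arcs leaving v are (v , i), i : Fin (d v)).
-- The rotor mechanism at v is the ordering e_v^1,...,e_v^{d v} given by the index i,
-- and e^+ is the arc with index cyc i.
-- T v ≡ true  means v is a target; V0 = { v | T v ≡ false }.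
module Rotor (n : ℕ) (d : Fin n → ℕ) (hd : (v : Fin n) → Fin (d v) → Fin n)
             (T : Fin n → Bool) where

  data Reach (u : Fin n) : Fin n → Set where
    here  : Reach u u
    there : ∀ {v} → Reach u v → (i : Fin (d v)) → Reach u (hd v i)

  StronglyConnected : Set
  StronglyConnected = ∀ u w → Reach u w

  -- rotor configuration: ρ v = index of the current rotor arc at v
  -- (values at targets are irrelevant; configurations are compared on V0 only)
  RotorConfig : Set
  RotorConfig = (v : Fin n) → Fin (d v)

  _≈ʳ_ : RotorConfig → RotorConfig → Set
  ρ ≈ʳ ρ' = ∀ v → T v ≡ false → ρ v ≡ ρ' v

  advance : RotorConfig → Fin n → RotorConfig
  advance ρ v w with w ≟ v
  ... | yes w≡v = subst (λ x → Fin (d x)) (sym w≡v) (cyc (ρ v))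
  ... | no  _   = ρ w

  nextVertex : RotorConfig → Fin n → Fin n
  nextVertex ρ v = hd v (cyc (ρ v))

  data Walk : RotorConfig → Fin n → Fin n → Set where
    stop : ∀ {ρ v} → T (nextVertex ρ v) ≡ true → Walk ρ v (nextVertex ρ v)
    go   : ∀ {ρ v t} → T (nextVertex ρ v) ≡ false →
           Walk (advance ρ v) (nextVertex ρ v) t → Walk ρ v t

  Particles : Set
  Particles = Fin n → ℕ

  setP : Particles → Fin n → ℕ → Particles
  setP σ v k w with w ≟ v
  ... | yes _ = k
  ... | no  _ = σ w

  addP : Particles → Fin n → Particles
  addP σ w with T w
  ... | true  = σ
  ... | false = setP σ w (suc (σ w))

  data Run : Particles → RotorConfig → RotorConfig → Set where
    done : ∀ {σ ρ} → (∀ v → T v ≡ false → σ v ≡ 0) → Run σ ρ ρ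
    step : ∀ {σ ρ ρ' k} (v : Fin n) → T v ≡ false → σ v ≡ suc k →
           Run (addP (setP σ v k) (nextVertex ρ v)) (advance ρ v) ρ' →
           Run σ ρ ρ'

  Equiv : RotorConfig → RotorConfig → Set
  Equiv ρ₁ ρ₂ = Σ Particles λ σ → Σ RotorConfig λ ρa → Σ RotorConfig λ ρb →
                Run σ ρ₁ ρa × Run σ ρ₂ ρb × (ρa ≈ʳ ρb)

module Submission where

-- A complete run of particles σ from rotors ρ is described by its odometer N (how often
-- each vertex fires): off the targets, N = σ + (particles sent by the firings N), and N is
-- the least such supersolution.  Two runs of the same σ that end in the same rotors deliver
-- the same number of particles to each target: where one odometer exceeds the other, the
-- surplus firings send their particles back into that same set, never to a target.
-- Now let σρ₁ = σρ₂ = τ.  Walking one extra particle from v after the run of σ, or before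
-- it (its odometer being least, it fits inside the combined one), gives the same
-- deliveries, so  δ(t_v ρᵢ) + (σ run after the walk) = (σ run from ρᵢ) + δ(t_v τ)  for
-- i = 1, 2; both runs of σ after the walks end in the same rotors, hence deliver alike, and
-- t_v ρ₁ = t_v ρ₂.  Walks terminate: until the particle stops, a target receives nothing and
-- any other vertex at most one particle more than it fires, while F firings at x send at
-- least ⌊F / d x⌋ particles along each arc, so a path to a target bounds every firing count.

open import Defs
open import Data.Nat hiding (_≟_)
open import Data.Nat.Properties hiding (_≟_; suc-injective)
open import Data.Nat.DivMod using (_%_; m%n<n; m<n⇒m%n≡m; m%n%n≡m%n; %-distribˡ-+; [m+n]%n≡m%n; [m+kn]%n≡m%n)
open import Algebra.Properties.CommutativeSemigroup +-commutativeSemigroup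
  using (interchange; xy∙z≈xz∙y)
open import Algebra.Properties.CommutativeMonoid.Sum +-0-commutativeMonoid
  using (sum; sum-syntax; ∑-distrib-+; ∑-comm; sum-cong-≗; sum-replicate-zero)
open import Data.Bool using (Bool; true; false; not; if_then_else_)
open import Data.Fin using (Fin; zero; suc; toℕ; _≟_)
open import Data.Fin.Properties using (toℕ-injective; toℕ-fromℕ<; toℕ<n; suc-injective)
open import Data.Product using (Σ; ∃; _×_; _,_)
open import Data.Sum using (inj₁; inj₂)
open import Function using (_∘_)
open import Relation.Binary.PropositionalEquality
open import Relation.Nullary using (Dec; yes; no; contradiction)

-- Sums over Fin and the Kronecker delta

∑-≤ : ∀ {m} (f : Fin m → ℕ) i → f i ≤ ∑[ j < m ] f j
∑-≤ f zero = m≤m+n _ _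
∑-≤ f (suc i) = ≤-trans (∑-≤ (f ∘ suc) i) (m≤n+m _ (f zero))

∑-mono-≤ : ∀ {m} {f g : Fin m → ℕ} → (∀ i → f i ≤ g i) → sum f ≤ sum g
∑-mono-≤ {zero} f≤g = z≤n
∑-mono-≤ {suc m} f≤g = +-mono-≤ (f≤g zero) (∑-mono-≤ (f≤g ∘ suc))

∑≡0⇒≡0 : ∀ {m} (f : Fin m → ℕ) → sum f ≡ 0 → ∀ i → f i ≡ 0
∑≡0⇒≡0 f ∑f≡0 i = n≤0⇒n≡0 (subst (f i ≤_) ∑f≡0 (∑-≤ f i))

∑-zero : ∀ m → ∑[ i < m ] 0 ≡ 0
∑-zero m = sum-replicate-zero m

δ : ∀ {m} → Fin m → Fin m → ℕ
δ a x with a ≟ x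
... | yes _ = 1
... | no  _ = 0

δ-refl : ∀ {m} (a : Fin m) → δ a a ≡ 1
δ-refl a with a ≟ a
... | yes _ = refl
... | no a≢a = contradiction refl a≢a

δ-≢ : ∀ {m} {a b : Fin m} → a ≢ b → δ a b ≡ 0
δ-≢ {a = a} {b} a≢b with a ≟ b
... | yes a≡b = contradiction a≡b a≢b
... | no _ = refl

δ≡1⇒≡ : ∀ {m} {a b : Fin m} → δ a b ≡ 1 → a ≡ b
δ≡1⇒≡ {a = a} {b} eq with a ≟ b
... | yes a≡b = a≡b

δ≤1 : ∀ {m} (a b : Fin m) → δ a b ≤ 1
δ≤1 a b with a ≟ b
... | yes _ = s≤s z≤n
... | no _ = z≤n

δ-suc : ∀ {m} (a x : Fin m) → δ (suc a) (suc x) ≡ δ a x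
δ-suc a x = by-cases (a ≟ x)
  where
  by-cases : Dec (a ≡ x) → δ (suc a) (suc x) ≡ δ a x
  by-cases (yes refl) = trans (δ-refl (suc a)) (sym (δ-refl a))
  by-cases (no a≢x) = trans (δ-≢ (a≢x ∘ suc-injective)) (sym (δ-≢ a≢x))

∑-δ* : ∀ {m} (a : Fin m) c → ∑[ x < m ] (δ a x * c) ≡ c
∑-δ* {suc m} zero c = begin
  1 * c + ∑[ x < m ] (δ zero (suc x) * c) ≡⟨ cong (1 * c +_) (sum-cong-≗ {m} λ x → cong (_* c) (δ-≢ {a = zero} {suc x} λ ())) ⟩
  1 * c + ∑[ x < m ] 0                    ≡⟨ cong (1 * c +_) (∑-zero m) ⟩
  1 * c + 0                               ≡⟨ trans (+-identityʳ _) (*-identityˡ c) ⟩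
  c                                       ∎
  where open ≡-Reasoning
∑-δ* {suc m} (suc a) c = begin
  δ (suc a) zero * c + ∑[ x < m ] (δ (suc a) (suc x) * c) ≡⟨ cong₂ _+_ (cong (_* c) (δ-≢ {a = suc a} {zero} λ ())) (sum-cong-≗ {m} λ x → cong (_* c) (δ-suc a x)) ⟩
  0 + ∑[ x < m ] (δ a x * c)                              ≡⟨ ∑-δ* a c ⟩
  c                                                       ∎
  where open ≡-Reasoning

∑-δ : ∀ {m} (a : Fin m) → ∑[ x < m ] δ a x ≡ 1
∑-δ {m} a = trans (sum-cong-≗ λ x → sym (*-identityʳ (δ a x))) (∑-δ* a 1)

-- Iterated rotor steps

[m+n%d]%d≡[m+n]%d : ∀ m n d .{{_ : NonZero d}} → (m + n % d) % d ≡ (m + n) % d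
[m+n%d]%d≡[m+n]%d m n d = begin
  (m + n % d) % d           ≡⟨ %-distribˡ-+ m (n % d) d ⟩
  (m % d + n % d % d) % d   ≡⟨ cong (λ z → (m % d + z) % d) (m%n%n≡m%n n d) ⟩
  (m % d + n % d) % d       ≡⟨ %-distribˡ-+ m n d ⟨
  (m + n) % d               ∎
  where open ≡-Reasoning

rotate : ∀ {k} → ℕ → Fin k → Fin k
rotate zero r = r
rotate (suc m) r = rotate m (cyc r)

rotate-+ : ∀ {k} a b (r : Fin k) → rotate (a + b) r ≡ rotate b (rotate a r)
rotate-+ zero b r = refl
rotate-+ (suc a) b r = rotate-+ a b (cyc r)

rotate-suc : ∀ {k} m (r : Fin k) → rotate (suc m) r ≡ cyc (rotate m r)
rotate-suc m r = trans (cong (λ z → rotate z r) (+-comm 1 m)) (rotate-+ m 1 r)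

toℕ-rotate : ∀ {k} m (r : Fin (suc k)) → toℕ (rotate m r) ≡ (toℕ r + m) % suc k
toℕ-rotate zero r = sym (trans (cong (_% _) (+-identityʳ (toℕ r))) (m<n⇒m%n≡m (toℕ<n r)))
toℕ-rotate {k} (suc m) r = begin
  toℕ (rotate m (cyc r))           ≡⟨ toℕ-rotate m (cyc r) ⟩
  (toℕ (cyc r) + m) % suc k        ≡⟨ cong (λ z → (z + m) % suc k) (toℕ-fromℕ< (m%n<n (suc (toℕ r)) (suc k))) ⟩
  (suc (toℕ r) % suc k + m) % suc k ≡⟨ cong (_% suc k) (+-comm _ m) ⟩
  (m + suc (toℕ r) % suc k) % suc k ≡⟨ [m+n%d]%d≡[m+n]%d m (suc (toℕ r)) (suc k) ⟩
  (m + suc (toℕ r)) % suc k        ≡⟨ cong (_% suc k) (trans (+-comm m _) (sym (+-suc (toℕ r) m))) ⟩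
  (toℕ r + suc m) % suc k          ∎
  where open ≡-Reasoning

rotate-periodic : ∀ {k} q (r : Fin k) → rotate (q * k) r ≡ r
rotate-periodic {suc k} q r = toℕ-injective (begin
  toℕ (rotate (q * suc k) r)     ≡⟨ toℕ-rotate (q * suc k) r ⟩
  (toℕ r + q * suc k) % suc k   ≡⟨ [m+kn]%n≡m%n (toℕ r) q (suc k) ⟩
  toℕ r % suc k                 ≡⟨ m<n⇒m%n≡m (toℕ<n r) ⟩
  toℕ r                         ∎)
  where open ≡-Reasoning

rotate-injective : ∀ {k} m {i j : Fin k} → rotate m i ≡ rotate m j → i ≡ j
rotate-injective {suc k} m {i} {j} eq = trans (sym (unrotate i)) (trans (cong (rotate (k * m)) eq) (unrotate j))
  where
  unrotate : ∀ r → rotate (k * m) (rotate m r) ≡ r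
  unrotate r = begin
    rotate (k * m) (rotate m r) ≡⟨ rotate-+ m (k * m) r ⟨
    rotate (suc k * m) r        ≡⟨ cong (λ z → rotate z r) (*-comm (suc k) m) ⟩
    rotate (m * suc k) r        ≡⟨ rotate-periodic m r ⟩
    r                           ∎
    where open ≡-Reasoning

rotate-∸ : ∀ {k a b} (r s : Fin k) → b ≤ a → rotate a r ≡ rotate b s → rotate (a ∸ b) r ≡ s
rotate-∸ {a = a} {b} r s b≤a eq = rotate-injective b (begin
  rotate b (rotate (a ∸ b) r) ≡⟨ rotate-+ (a ∸ b) b r ⟨
  rotate (a ∸ b + b) r        ≡⟨ cong (λ z → rotate z r) (m∸n+n≡m b≤a) ⟩
  rotate a r                  ≡⟨ eq ⟩
  rotate b s                  ∎)
  where open ≡-Reasoning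

-- The witness is j = (k − 1 − r + i) mod k, so that r + 1 + j ≡ i (mod k).
rotate-reaches : ∀ {k} (r i : Fin k) → ∃ λ j → j < k × rotate (suc j) r ≡ i
rotate-reaches {suc k} r i = j , m%n<n (k ∸ toℕ r + toℕ i) (suc k) , toℕ-injective (begin
  toℕ (rotate (suc j) r)                      ≡⟨ toℕ-rotate (suc j) r ⟩
  (toℕ r + suc j) % suc k                     ≡⟨ cong (_% suc k) (+-suc (toℕ r) j) ⟩
  (suc (toℕ r) + j) % suc k                   ≡⟨ [m+n%d]%d≡[m+n]%d (suc (toℕ r)) (k ∸ toℕ r + toℕ i) (suc k) ⟩
  (suc (toℕ r) + (k ∸ toℕ r + toℕ i)) % suc k ≡⟨ cong (λ z → suc z % suc k) (trans (sym (+-assoc (toℕ r) _ (toℕ i))) (cong (_+ toℕ i) (m+[n∸m]≡n r≤k))) ⟩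
  (suc k + toℕ i) % suc k                     ≡⟨ cong (_% suc k) (+-comm (suc k) (toℕ i)) ⟩
  (toℕ i + suc k) % suc k                     ≡⟨ [m+n]%n≡m%n (toℕ i) (suc k) ⟩
  toℕ i % suc k                               ≡⟨ m<n⇒m%n≡m (toℕ<n i) ⟩
  toℕ i                                       ∎)
  where
  open ≡-Reasoning
  j = (k ∸ toℕ r + toℕ i) % suc k
  r≤k : toℕ r ≤ k
  r≤k = s≤s⁻¹ (toℕ<n r)

sent : ∀ {k m} → (Fin k → Fin m) → Fin k → ℕ → Fin m → ℕ
sent h r zero x = 0
sent h r (suc j) x = δ (h (cyc r)) x + sent h (cyc r) j x

module _ {k m} (h : Fin k → Fin m) where

  sent-+ : ∀ a b r x → sent h r (a + b) x ≡ sent h r a x + sent h (rotate a r) b x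
  sent-+ zero b r x = refl
  sent-+ (suc a) b r x = trans (cong (δ (h (cyc r)) x +_) (sent-+ a b (cyc r) x)) (sym (+-assoc (δ (h (cyc r)) x) _ _))

  ∑-sent : ∀ r j → ∑[ x < m ] sent h r j x ≡ j
  ∑-sent r zero = ∑-zero m
  ∑-sent r (suc j) = begin
    ∑[ x < m ] (δ (h (cyc r)) x + sent h (cyc r) j x)          ≡⟨ ∑-distrib-+ (δ (h (cyc r))) (sent h (cyc r) j) ⟩
    ∑[ x < m ] δ (h (cyc r)) x + ∑[ x < m ] sent h (cyc r) j x ≡⟨ cong₂ _+_ (∑-δ (h (cyc r))) (∑-sent (cyc r) j) ⟩
    suc j                                                       ∎
    where open ≡-Reasoning

  sent-split : ∀ {a b} (r s : Fin k) → b ≤ a → rotate a r ≡ rotate b s →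
               ∀ x → sent h r a x ≡ sent h r (a ∸ b) x + sent h s b x
  sent-split {a} {b} r s b≤a eq x = begin
    sent h r a x                                         ≡⟨ cong (λ z → sent h r z x) (m∸n+n≡m b≤a) ⟨
    sent h r (a ∸ b + b) x                               ≡⟨ sent-+ (a ∸ b) b r x ⟩
    sent h r (a ∸ b) x + sent h (rotate (a ∸ b) r) b x   ≡⟨ cong (λ t → sent h r (a ∸ b) x + sent h t b x) (rotate-∸ r s b≤a eq) ⟩
    sent h r (a ∸ b) x + sent h s b x                    ∎
    where open ≡-Reasoning

  sent-last : ∀ j r → 1 ≤ sent h r (suc j) (h (rotate (suc j) r))
  sent-last j r = begin
    1                                              ≡⟨ δ-refl y ⟨
    δ y y                                          ≡⟨ cong (λ z → δ (h z) y) (rotate-suc j r) ⟩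
    δ (h (cyc (rotate j r))) y                     ≤⟨ m≤m+n _ 0 ⟩
    sent h (rotate j r) 1 y                        ≤⟨ m≤n+m _ (sent h r j y) ⟩
    sent h r j y + sent h (rotate j r) 1 y         ≡⟨ sent-+ j 1 r y ⟨
    sent h r (j + 1) y                             ≡⟨ cong (λ z → sent h r z y) (+-comm j 1) ⟩
    sent h r (suc j) y                             ∎
    where
    open ≤-Reasoning
    y = h (rotate (suc j) r)

  -- Every window of k consecutive rotor steps uses every arc at least once.
  sent-≥ : ∀ q j r i → q * k ≤ j → q ≤ sent h r j (h i)
  sent-≥ zero j r i _ = z≤n
  sent-≥ (suc q) j r i q*k≤j with rotate-reaches r i
  ... | j' , j'<k , r→i = begin
    suc q                                                    ≤⟨ +-mono-≤ first (sent-≥ q (j ∸ suc j') i i rest≥) ⟩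
    sent h r (suc j') (h i) + sent h i (j ∸ suc j') (h i)    ≡⟨ cong (λ t → sent h r (suc j') (h i) + sent h t (j ∸ suc j') (h i)) r→i ⟨
    sent h r (suc j') (h i) + sent h (rotate (suc j') r) (j ∸ suc j') (h i) ≡⟨ sent-+ (suc j') (j ∸ suc j') r (h i) ⟨
    sent h r (suc j' + (j ∸ suc j')) (h i)                   ≡⟨ cong (λ z → sent h r z (h i)) (m+[n∸m]≡n (≤-trans j'<k (≤-trans (m≤m+n k (q * k)) q*k≤j))) ⟩
    sent h r j (h i)                                         ∎
    where
    open ≤-Reasoning
    first : 1 ≤ sent h r (suc j') (h i)
    first = subst (λ t → 1 ≤ sent h r (suc j') (h t)) r→i (sent-last j' r)
    rest≥ : q * k ≤ j ∸ suc j'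
    rest≥ = m+n≤o⇒m≤o∸n (q * k) (≤-trans (+-monoʳ-≤ (q * k) j'<k) (≤-trans (≤-reflexive (+-comm (q * k) k)) q*k≤j))

-- Surplus firings stay inside the surplus set

keep : Bool → ℕ → ℕ
keep b v = if b then v else 0

keep-+ : ∀ b v w → keep b (v + w) ≡ keep b v + keep b w
keep-+ true v w = refl
keep-+ false v w = refl

keep-split : ∀ b v → keep b v + keep (not b) v ≡ v
keep-split true v = +-identityʳ v
keep-split false v = refl

keep-∑ : ∀ {m} b (f : Fin m → ℕ) → keep b (sum f) ≡ ∑[ i < m ] keep b (f i)
keep-∑ true f = refl
keep-∑ {m} false f = sym (∑-zero m)

keep-comm : ∀ a b v → keep a (keep b v) ≡ keep b (keep a v)
keep-comm true b v = refl
keep-comm false true v = refl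
keep-comm false false v = refl

keep-mono-≤ : ∀ b {v w} → v ≤ w → keep b v ≤ keep b w
keep-mono-≤ true v≤w = v≤w
keep-mono-≤ false v≤w = z≤n

-- Read E¹ u as the N¹ u ∸ N² u particles u emits in excess under N¹, and E² likewise.
-- Only A = {x ∉ T | N² x < N¹ x} emits E¹-excess, and on A the surplus N¹ − N² equals the
-- E¹-excess received minus the E²-excess received.  Summed over A, the E¹-excess received
-- by A is thus at least all the E¹-excess A emits, so none of it leaves A.
excess-avoids-targets :
  ∀ {m} (T : Fin m → Bool) (N¹ N² : Fin m → ℕ) (E¹ E² : Fin m → Fin m → ℕ) →
  (∀ u → T u ≡ true → N¹ u ≡ 0) →
  (∀ u → ∑[ x < m ] E¹ u x ≡ N¹ u ∸ N² u) →
  (∀ x → T x ≡ false → N¹ x + ∑[ u < m ] E² u x ≡ N² x + ∑[ u < m ] E¹ u x) →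
  ∀ t → T t ≡ true → ∑[ u < m ] E¹ u t ≡ 0
excess-avoids-targets {m} T N¹ N² E¹ E² N¹-T ∑E¹ balance t Tt = n≤0⇒n≡0 (begin
  ∑[ u < m ] E¹ u t ≤⟨ ∑-mono-≤ {m} reaches-t≤leak ⟩
  leak              ≡⟨ leak≡0 ⟩
  0                 ∎)
  where
  open ≤-Reasoning
  A : Fin m → Bool
  A x with T x | N² x <? N¹ x
  ... | false | yes _ = true
  ... | _     | _     = false

  A-inside : ∀ x → A x ≡ true → T x ≡ false × N² x < N¹ x
  A-inside x Ax with T x | N² x <? N¹ x
  ... | false | yes lt = refl , lt

  A-outside : ∀ x → A x ≡ false → N¹ x ∸ N² x ≡ 0
  A-outside x Ax with T x in Tx | N² x <? N¹ x
  ... | true  | _     = trans (cong (_∸ N² x) (N¹-T x Tx)) (0∸n≡0 (N² x))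
  ... | false | no ≮  = m≤n⇒m∸n≡0 (≮⇒≥ ≮)

  A-target : ∀ x → T x ≡ true → A x ≡ false
  A-target x Tx with T x
  ... | true = refl

  emitted-by-A : ∀ u x → keep (A u) (E¹ u x) ≡ E¹ u x
  emitted-by-A u x with A u in Au
  ... | true  = refl
  ... | false = sym (∑≡0⇒≡0 (E¹ u) (trans (∑E¹ u) (A-outside u Au)) x)

  D S² : Fin m → ℕ
  D x = N¹ x ∸ N² x
  S² x = ∑[ u < m ] E² u x

  surplus : ∀ x → keep (A x) (D x + S² x) ≡ keep (A x) (∑[ u < m ] keep (A u) (E¹ u x))
  surplus x with A x in Ax
  ... | false = refl
  ... | true with A-inside x Ax
  ...   | Tx , N²<N¹ = +-cancelʳ-≡ (N² x) _ _ (begin-equality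
    D x + S² x + N² x               ≡⟨ xy∙z≈xz∙y (D x) (S² x) (N² x) ⟩
    D x + N² x + S² x               ≡⟨ cong (_+ S² x) (m∸n+n≡m (<⇒≤ N²<N¹)) ⟩
    N¹ x + S² x                     ≡⟨ balance x Tx ⟩
    N² x + ∑[ u < m ] E¹ u x        ≡⟨ cong (N² x +_) (sum-cong-≗ {m} λ u → emitted-by-A u x) ⟨
    N² x + ∑[ u < m ] keep (A u) (E¹ u x) ≡⟨ +-comm (N² x) _ ⟩
    ∑[ u < m ] keep (A u) (E¹ u x) + N² x ∎)

  Dᴬ S²ᴬ inner leak : ℕ
  Dᴬ = ∑[ x < m ] keep (A x) (D x)
  S²ᴬ = ∑[ x < m ] keep (A x) (S² x)
  inner = ∑[ u < m ] keep (A u) (∑[ x < m ] keep (A x) (E¹ u x))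
  leak = ∑[ u < m ] keep (A u) (∑[ x < m ] keep (not (A x)) (E¹ u x))

  received : Dᴬ + S²ᴬ ≡ inner
  received = begin-equality
    Dᴬ + S²ᴬ                                                        ≡⟨ ∑-distrib-+ {m} (λ x → keep (A x) (D x)) (λ x → keep (A x) (S² x)) ⟨
    ∑[ x < m ] (keep (A x) (D x) + keep (A x) (S² x))               ≡⟨ sum-cong-≗ {m} (λ x → trans (sym (keep-+ (A x) (D x) (S² x))) (surplus x)) ⟩
    ∑[ x < m ] keep (A x) (∑[ u < m ] keep (A u) (E¹ u x))          ≡⟨ sum-cong-≗ {m} (λ x → trans (keep-∑ {m} (A x) _) (sum-cong-≗ {m} λ u → keep-comm (A x) (A u) (E¹ u x))) ⟩
    ∑[ x < m ] ∑[ u < m ] keep (A u) (keep (A x) (E¹ u x))          ≡⟨ ∑-comm (λ x u → keep (A u) (keep (A x) (E¹ u x))) ⟩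
    ∑[ u < m ] ∑[ x < m ] keep (A u) (keep (A x) (E¹ u x))          ≡⟨ sum-cong-≗ {m} (λ u → keep-∑ {m} (A u) _) ⟨
    inner                                                           ∎

  emitted : Dᴬ ≡ inner + leak
  emitted = begin-equality
    Dᴬ                                                              ≡⟨ sum-cong-≗ {m} (λ u → cong (keep (A u)) (sym (∑E¹ u))) ⟩
    ∑[ u < m ] keep (A u) (∑[ x < m ] E¹ u x)                       ≡⟨ sum-cong-≗ {m} (λ u → cong (keep (A u)) (sum-cong-≗ {m} λ x → sym (keep-split (A x) (E¹ u x)))) ⟩
    ∑[ u < m ] keep (A u) (∑[ x < m ] (keep (A x) (E¹ u x) + keep (not (A x)) (E¹ u x)))
                                                                    ≡⟨ sum-cong-≗ {m} (λ u → trans (cong (keep (A u)) (∑-distrib-+ {m} _ _)) (keep-+ (A u) _ _)) ⟩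
    ∑[ u < m ] (keep (A u) (∑[ x < m ] keep (A x) (E¹ u x)) + keep (A u) (∑[ x < m ] keep (not (A x)) (E¹ u x)))
                                                                    ≡⟨ ∑-distrib-+ {m} _ _ ⟩
    inner + leak                                                    ∎

  leak≡0 : leak ≡ 0
  leak≡0 = m+n≡0⇒m≡0 leak (+-cancelˡ-≡ inner _ _ (begin-equality
    inner + (leak + S²ᴬ) ≡⟨ +-assoc inner leak S²ᴬ ⟨
    inner + leak + S²ᴬ   ≡⟨ cong (_+ S²ᴬ) emitted ⟨
    Dᴬ + S²ᴬ             ≡⟨ received ⟩
    inner                ≡⟨ +-identityʳ inner ⟨
    inner + 0            ∎))

  reaches-t≤leak : ∀ u → E¹ u t ≤ keep (A u) (∑[ x < m ] keep (not (A x)) (E¹ u x))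
  reaches-t≤leak u = begin
    E¹ u t                                          ≡⟨ emitted-by-A u t ⟨
    keep (A u) (E¹ u t)                             ≡⟨ cong (λ b → keep (A u) (keep (not b) (E¹ u t))) (A-target t Tt) ⟨
    keep (A u) (keep (not (A t)) (E¹ u t))          ≤⟨ keep-mono-≤ (A u) (∑-≤ (λ x → keep (not (A x)) (E¹ u x)) t) ⟩
    keep (A u) (∑[ x < m ] keep (not (A x)) (E¹ u x)) ∎

-- Odometers of rotor walks

module RotorWalks (n : ℕ) (d : Fin n → ℕ) (hd : (v : Fin n) → Fin (d v) → Fin n)
                     (T : Fin n → Bool) where
  open Rotor n d hd T

  Odometer : Set
  Odometer = Fin n → ℕ

  IdleOnTargets : Odometer → Set
  IdleOnTargets N = ∀ t → T t ≡ true → N t ≡ 0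

  emitted : RotorConfig → Odometer → Fin n → ℕ
  emitted ρ N x = ∑[ u < n ] sent (hd u) (ρ u) (N u) x

  fire : RotorConfig → Odometer → RotorConfig
  fire ρ N u = rotate (N u) (ρ u)

  -- N is the odometer of a complete run of σ from ρ: each particle ever present at a
  -- non-target x, initially or sent there, is fired from x exactly once.
  record Settles (ρ : RotorConfig) (σ : Particles) (N : Odometer) : Set where
    field
      idle : IdleOnTargets N
      balance : ∀ x → T x ≡ false → N x ≡ σ x + emitted ρ N x
  open Settles

  Supersolution : RotorConfig → Particles → Odometer → Set
  Supersolution ρ σ N = ∀ x → T x ≡ false → σ x + emitted ρ N x ≤ N x

  Least : RotorConfig → Particles → Odometer → Set
  Least ρ σ N = ∀ N' → Supersolution ρ σ N' → ∀ x → N x ≤ N' x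

  DeliversTo : RotorConfig → Odometer → Fin n → Set
  DeliversTo ρ N t = ∀ t' → T t' ≡ true → emitted ρ N t' ≡ δ t t'

  ≈ʳ-sym : ∀ {ρ ρ'} → ρ ≈ʳ ρ' → ρ' ≈ʳ ρ
  ≈ʳ-sym ρ≈ρ' u Tu = sym (ρ≈ρ' u Tu)

  ≈ʳ-trans : ∀ {ρ ρ' ρ''} → ρ ≈ʳ ρ' → ρ' ≈ʳ ρ'' → ρ ≈ʳ ρ''
  ≈ʳ-trans ρ≈ρ' ρ'≈ρ'' u Tu = trans (ρ≈ρ' u Tu) (ρ'≈ρ'' u Tu)

  T-true≢false : ∀ {a b} → T a ≡ true → T b ≡ false → a ≢ b
  T-true≢false Ta Tb refl with trans (sym Ta) Tb
  ... | ()

  advance-self : ∀ ρ v → advance ρ v v ≡ cyc (ρ v)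
  advance-self ρ v with v ≟ v
  ... | yes refl = refl
  ... | no v≢v = contradiction refl v≢v

  advance-other : ∀ ρ {v u} → v ≢ u → advance ρ v u ≡ ρ u
  advance-other ρ {v} {u} v≢u with u ≟ v
  ... | yes u≡v = contradiction (sym u≡v) v≢u
  ... | no _ = refl

  emitted-zero : ∀ ρ x → emitted ρ (λ _ → 0) x ≡ 0
  emitted-zero ρ x = ∑-zero n

  emitted-cong : ∀ ρ {N N'} → (∀ u → N u ≡ N' u) → ∀ x → emitted ρ N x ≡ emitted ρ N' x
  emitted-cong ρ N≗N' x = sum-cong-≗ {n} λ u → cong (λ k → sent (hd u) (ρ u) k x) (N≗N' u)

  settles-zero : ∀ ρ σ → (∀ x → T x ≡ false → σ x ≡ 0) → Settles ρ σ (λ _ → 0)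
  settles-zero ρ σ σ≡0 = record
    { idle = λ _ _ → refl
    ; balance = λ x Tx → sym (cong₂ _+_ (σ≡0 x Tx) (emitted-zero ρ x)) }

  module Step (ρ : RotorConfig) (v : Fin n) (Tv : T v ≡ false) where
    w : Fin n
    w = nextVertex ρ v

    ρ⁺ : RotorConfig
    ρ⁺ = advance ρ v

    _⁺ : Odometer → Odometer
    (F ⁺) u = δ v u + F u

    sent-step : ∀ F u y → sent (hd u) (ρ u) ((F ⁺) u) y ≡ δ v u * δ w y + sent (hd u) (ρ⁺ u) (F u) y
    sent-step F u y with v ≟ u
    ... | yes refl = cong₂ _+_ (sym (+-identityʳ _)) (cong (λ r → sent (hd v) r (F v) y) (sym (advance-self ρ v)))
    ... | no v≢u = cong (λ r → sent (hd u) r (F u) y) (sym (advance-other ρ v≢u))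

    emitted-step : ∀ F y → emitted ρ (F ⁺) y ≡ δ w y + emitted ρ⁺ F y
    emitted-step F y = begin
      emitted ρ (F ⁺) y                                                     ≡⟨ sum-cong-≗ {n} (λ u → sent-step F u y) ⟩
      ∑[ u < n ] (δ v u * δ w y + sent (hd u) (ρ⁺ u) (F u) y)              ≡⟨ ∑-distrib-+ {n} (λ u → δ v u * δ w y) _ ⟩
      ∑[ u < n ] (δ v u * δ w y) + emitted ρ⁺ F y                           ≡⟨ cong (_+ emitted ρ⁺ F y) (∑-δ* v (δ w y)) ⟩
      δ w y + emitted ρ⁺ F y                                                ∎
      where open ≡-Reasoning

    fire-step : ∀ F u → fire ρ⁺ F u ≡ fire ρ (F ⁺) u
    fire-step F u with v ≟ u
    ... | yes refl = cong (rotate (F v)) (advance-self ρ v)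
    ... | no v≢u = cong (rotate (F u)) (advance-other ρ v≢u)

    module _ {σ σ' : Particles} (moved : ∀ x → T x ≡ false → σ' x + δ v x ≡ σ x + δ w x) where

      shift : ∀ F x → T x ≡ false → δ v x + (σ' x + emitted ρ⁺ F x) ≡ σ x + emitted ρ (F ⁺) x
      shift F x Tx = begin
        δ v x + (σ' x + emitted ρ⁺ F x)    ≡⟨ +-assoc (δ v x) (σ' x) _ ⟨
        δ v x + σ' x + emitted ρ⁺ F x      ≡⟨ cong (_+ emitted ρ⁺ F x) (trans (+-comm (δ v x) (σ' x)) (moved x Tx)) ⟩
        σ x + δ w x + emitted ρ⁺ F x       ≡⟨ +-assoc (σ x) _ _ ⟩
        σ x + (δ w x + emitted ρ⁺ F x)     ≡⟨ cong (σ x +_) (emitted-step F x) ⟨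
        σ x + emitted ρ (F ⁺) x            ∎
        where open ≡-Reasoning

      settles-step : ∀ F → Settles ρ⁺ σ' F → Settles ρ σ (F ⁺)
      settles-step F F-settles = record
        { idle = λ t Tt → trans (cong (_+ F t) (δ-≢ (T-true≢false Tt Tv ∘ sym))) (idle F-settles t Tt)
        ; balance = λ x Tx → trans (cong (δ v x +_) (balance F-settles x Tx)) (shift F x Tx) }

      -- A supersolution N fires v at least once, and N − δ v is a supersolution after the step.
      least-step : 1 ≤ σ v → ∀ F → Least ρ⁺ σ' F → Least ρ σ (F ⁺)
      least-step 1≤σv F F-least N N-super x = begin
        δ v x + F x               ≤⟨ +-monoʳ-≤ (δ v x) (F-least N⁻ N⁻-super x) ⟩
        δ v x + N⁻ x              ≡⟨ N≡N⁻⁺ x ⟨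
        N x                       ∎
        where
        open ≤-Reasoning
        N⁻ : Odometer
        N⁻ u = N u ∸ δ v u
        N≡N⁻⁺ : ∀ u → N u ≡ (N⁻ ⁺) u
        N≡N⁻⁺ u with v ≟ u
        ... | yes refl = sym (m+[n∸m]≡n (≤-trans 1≤σv (≤-trans (m≤m+n (σ v) _) (N-super v Tv))))
        ... | no _ = refl
        N⁻-super : Supersolution ρ⁺ σ' N⁻
        N⁻-super y Ty = +-cancelˡ-≤ (δ v y) _ _ (begin
          δ v y + (σ' y + emitted ρ⁺ N⁻ y) ≡⟨ shift N⁻ y Ty ⟩
          σ y + emitted ρ (N⁻ ⁺) y         ≡⟨ cong (σ y +_) (emitted-cong ρ N≡N⁻⁺ y) ⟨
          σ y + emitted ρ N y              ≤⟨ N-super y Ty ⟩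
          N y                              ≡⟨ N≡N⁻⁺ y ⟩
          δ v y + N⁻ y                     ∎)

  setP-δ : ∀ (σ : Particles) v k → σ v ≡ suc k → ∀ x → setP σ v k x + δ v x ≡ σ x
  setP-δ σ v k σv≡ x with x ≟ v
  ... | yes refl = trans (cong (k +_) (δ-refl x)) (trans (+-comm k 1) (sym σv≡))
  ... | no x≢v = trans (cong (σ x +_) (δ-≢ (x≢v ∘ sym))) (+-identityʳ _)

  addP-δ : ∀ (σ : Particles) w x → T x ≡ false → addP σ w x ≡ σ x + δ w x
  addP-δ σ w x Tx with T w in Tw
  ... | true = sym (trans (cong (σ x +_) (δ-≢ (T-true≢false Tw Tx))) (+-identityʳ _))
  ... | false with x ≟ w
  ...   | yes refl = trans (+-comm 1 (σ x)) (cong (σ x +_) (sym (δ-refl x)))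
  ...   | no x≢w = sym (trans (cong (σ x +_) (δ-≢ (x≢w ∘ sym))) (+-identityʳ _))

  run-odometer : ∀ {σ ρ ρ'} → Run σ ρ ρ' → ∃ λ N → Settles ρ σ N × Least ρ σ N × fire ρ N ≈ʳ ρ'
  run-odometer {σ} {ρ} (done σ≡0) = (λ _ → 0) , settles-zero ρ σ σ≡0 , (λ _ _ _ → z≤n) , λ _ _ → refl
  run-odometer {σ} {ρ} (step {k = k} v Tv σv≡ run) with run-odometer run
  ... | F , F-settles , F-least , F-ends =
    F ⁺ , settles-step moved F F-settles , least-step moved 1≤σv F F-least , λ u Tu → trans (sym (fire-step F u)) (F-ends u Tu)
    where
    open Step ρ v Tv
    1≤σv : 1 ≤ σ v
    1≤σv = subst (1 ≤_) (sym σv≡) (s≤s z≤n)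
    moved : ∀ x → T x ≡ false → addP (setP σ v k) w x + δ v x ≡ σ x + δ w x
    moved x Tx = begin
      addP (setP σ v k) w x + δ v x       ≡⟨ cong (_+ δ v x) (addP-δ (setP σ v k) w x Tx) ⟩
      setP σ v k x + δ w x + δ v x        ≡⟨ xy∙z≈xz∙y (setP σ v k x) (δ w x) (δ v x) ⟩
      setP σ v k x + δ v x + δ w x        ≡⟨ cong (_+ δ w x) (setP-δ σ v k σv≡ x) ⟩
      σ x + δ w x                         ∎
      where open ≡-Reasoning

  walk-odometer : ∀ {ρ v t} → Walk ρ v t → T v ≡ false →
                  T t ≡ true × ∃ λ M → Settles ρ (δ v) M × Least ρ (δ v) M × DeliversTo ρ M t
  walk-odometer {ρ} {v} (stop Tw) Tv =
    Tw , O ⁺ , settles-step moved O (settles-zero ρ⁺ O λ _ _ → refl) ,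
    least-step moved (≤-reflexive (sym (δ-refl v))) O (λ _ _ _ → z≤n) , delivers
    where
    open Step ρ v Tv
    O : Odometer
    O _ = 0
    moved : ∀ x → T x ≡ false → O x + δ v x ≡ δ v x + δ w x
    moved x Tx = sym (trans (cong (δ v x +_) (δ-≢ (T-true≢false Tw Tx))) (+-identityʳ _))
    delivers : DeliversTo ρ (O ⁺) w
    delivers t Tt = trans (emitted-step O t) (trans (cong (δ w t +_) (emitted-zero ρ⁺ t)) (+-identityʳ _))
  walk-odometer {ρ} {v} (go Tw walk) Tv with walk-odometer walk Tw
  ... | Tt , M , M-settles , M-least , M-delivers =
    Tt , M ⁺ , settles-step moved M M-settles , least-step moved (≤-reflexive (sym (δ-refl v))) M M-least , delivers
    where
    open Step ρ v Tv
    moved : ∀ x → T x ≡ false → δ w x + δ v x ≡ δ v x + δ w x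
    moved x Tx = +-comm (δ w x) (δ v x)
    delivers : DeliversTo ρ (M ⁺) _
    delivers t Tt' = trans (emitted-step M t) (trans (cong (_+ emitted ρ⁺ M t) (δ-≢ (T-true≢false Tt' Tw ∘ sym))) (M-delivers t Tt'))

  emitted-≈ʳ : ∀ {ρ ρ'} K → IdleOnTargets K → ρ ≈ʳ ρ' → ∀ x → emitted ρ K x ≡ emitted ρ' K x
  emitted-≈ʳ {ρ} {ρ'} K K-idle ρ≈ρ' x = sum-cong-≗ {n} same-sent
    where
    same-sent : ∀ u → sent (hd u) (ρ u) (K u) x ≡ sent (hd u) (ρ' u) (K u) x
    same-sent u with T u in Tu
    ... | true rewrite K-idle u Tu = refl
    ... | false = cong (λ r → sent (hd u) r (K u) x) (ρ≈ρ' u Tu)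

  emitted-+ : ∀ ρ {ρ'} N K → IdleOnTargets K → fire ρ N ≈ʳ ρ' →
              ∀ x → emitted ρ (λ u → N u + K u) x ≡ emitted ρ N x + emitted ρ' K x
  emitted-+ ρ N K K-idle fire≈ρ' x = begin
    emitted ρ (λ u → N u + K u) x                                           ≡⟨ sum-cong-≗ {n} (λ u → sent-+ (hd u) (N u) (K u) (ρ u) x) ⟩
    ∑[ u < n ] (sent (hd u) (ρ u) (N u) x + sent (hd u) (fire ρ N u) (K u) x) ≡⟨ ∑-distrib-+ {n} (λ u → sent (hd u) (ρ u) (N u) x) _ ⟩
    emitted ρ N x + emitted (fire ρ N) K x                                  ≡⟨ cong (emitted ρ N x +_) (emitted-≈ʳ K K-idle fire≈ρ' x) ⟩
    emitted ρ N x + emitted _ K x                                           ∎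
    where open ≡-Reasoning

  settles-+ : ∀ {ρ ρ' σ τ N K} → Settles ρ σ N → fire ρ N ≈ʳ ρ' → Settles ρ' τ K →
              Settles ρ (λ x → σ x + τ x) (λ u → N u + K u)
  settles-+ {ρ} {ρ'} {σ} {τ} {N} {K} N-settles fire≈ρ' K-settles = record
    { idle = λ t Tt → cong₂ _+_ (idle N-settles t Tt) (idle K-settles t Tt)
    ; balance = λ x Tx → begin
        N x + K x                                      ≡⟨ cong₂ _+_ (balance N-settles x Tx) (balance K-settles x Tx) ⟩
        (σ x + emitted ρ N x) + (τ x + emitted ρ' K x) ≡⟨ interchange (σ x) _ (τ x) _ ⟩
        (σ x + τ x) + (emitted ρ N x + emitted ρ' K x) ≡⟨ cong (σ x + τ x +_) (emitted-+ ρ N K (idle K-settles) fire≈ρ' x) ⟨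
        (σ x + τ x) + emitted ρ (λ u → N u + K u) x    ∎ }
    where open ≡-Reasoning

  settles-∸ : ∀ {ρ σ τ G M} → Settles ρ (λ x → σ x + τ x) G → Settles ρ τ M → (∀ u → M u ≤ G u) →
              Settles (fire ρ M) σ (λ u → G u ∸ M u)
  settles-∸ {ρ} {σ} {τ} {G} {M} G-settles M-settles M≤G = record
    { idle = L-idle
    ; balance = λ x Tx → +-cancelˡ-≡ (M x) _ _ (begin
        M x + L x                                          ≡⟨ G≡M+L x ⟨
        G x                                                ≡⟨ balance G-settles x Tx ⟩
        (σ x + τ x) + emitted ρ G x                        ≡⟨ cong (σ x + τ x +_) (emitted-cong ρ G≡M+L x) ⟩
        (σ x + τ x) + emitted ρ (λ u → M u + L u) x        ≡⟨ cong₂ _+_ (+-comm (σ x) (τ x)) (emitted-+ ρ M L L-idle (λ _ _ → refl) x) ⟩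
        (τ x + σ x) + (emitted ρ M x + emitted (fire ρ M) L x) ≡⟨ interchange (τ x) (σ x) _ _ ⟩
        (τ x + emitted ρ M x) + (σ x + emitted (fire ρ M) L x) ≡⟨ cong (_+ (σ x + emitted (fire ρ M) L x)) (balance M-settles x Tx) ⟨
        M x + (σ x + emitted (fire ρ M) L x)               ∎) }
    where
    open ≡-Reasoning
    L : Odometer
    L u = G u ∸ M u
    G≡M+L : ∀ u → G u ≡ M u + L u
    G≡M+L u = sym (m+[n∸m]≡n (M≤G u))
    L-idle : IdleOnTargets L
    L-idle t Tt = trans (cong (_∸ M t) (idle G-settles t Tt)) (0∸n≡0 (M t))

  delivered-unique : ∀ {ρ ρ' σ N¹ N²} → Settles ρ σ N¹ → Settles ρ' σ N² → fire ρ N¹ ≈ʳ fire ρ' N² →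
                     ∀ t → T t ≡ true → emitted ρ N¹ t ≡ emitted ρ' N² t
  delivered-unique {ρ} {ρ'} {σ} {N¹} {N²} N¹-settles N²-settles same-end t Tt = begin
    emitted ρ N¹ t                   ≡⟨ +-identityʳ _ ⟨
    emitted ρ N¹ t + 0               ≡⟨ cong (emitted ρ N¹ t +_) excess²-avoids-t ⟨
    emitted ρ N¹ t + ∑E² t           ≡⟨ exchange t ⟩
    emitted ρ' N² t + ∑E¹ t          ≡⟨ cong (emitted ρ' N² t +_) excess¹-avoids-t ⟩
    emitted ρ' N² t + 0              ≡⟨ +-identityʳ _ ⟩
    emitted ρ' N² t                  ∎
    where
    open ≡-Reasoning
    E¹ E² : Fin n → Fin n → ℕ
    E¹ u x = sent (hd u) (ρ u) (N¹ u ∸ N² u) x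
    E² u x = sent (hd u) (ρ' u) (N² u ∸ N¹ u) x
    ∑E¹ ∑E² : Fin n → ℕ
    ∑E¹ x = ∑[ u < n ] E¹ u x
    ∑E² x = ∑[ u < n ] E² u x

    -- Both firing sequences at u end at the same rotor, so the longer is the shorter preceded by E.
    exchange-at : ∀ u x → sent (hd u) (ρ u) (N¹ u) x + E² u x ≡ sent (hd u) (ρ' u) (N² u) x + E¹ u x
    exchange-at u x with T u in Tu
    ... | true rewrite idle N¹-settles u Tu | idle N²-settles u Tu = refl
    ... | false with ≤-total (N² u) (N¹ u)
    ...   | inj₁ N²≤N¹ rewrite m≤n⇒m∸n≡0 N²≤N¹ = trans (+-identityʳ _)
            (trans (sent-split (hd u) (ρ u) (ρ' u) N²≤N¹ (same-end u Tu) x) (+-comm (E¹ u x) _))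
    ...   | inj₂ N¹≤N² rewrite m≤n⇒m∸n≡0 N¹≤N² = sym (trans (+-identityʳ _)
            (trans (sent-split (hd u) (ρ' u) (ρ u) N¹≤N² (sym (same-end u Tu)) x) (+-comm (E² u x) _)))

    exchange : ∀ x → emitted ρ N¹ x + ∑E² x ≡ emitted ρ' N² x + ∑E¹ x
    exchange x = trans (sym (∑-distrib-+ {n} (λ u → sent (hd u) (ρ u) (N¹ u) x) (λ u → E² u x)))
                   (trans (sum-cong-≗ {n} (λ u → exchange-at u x)) (∑-distrib-+ {n} (λ u → sent (hd u) (ρ' u) (N² u) x) (λ u → E¹ u x)))

    balance-excess : ∀ x → T x ≡ false → N¹ x + ∑E² x ≡ N² x + ∑E¹ x
    balance-excess x Tx = begin
      N¹ x + ∑E² x                       ≡⟨ cong (_+ ∑E² x) (balance N¹-settles x Tx) ⟩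
      σ x + emitted ρ N¹ x + ∑E² x       ≡⟨ +-assoc (σ x) _ _ ⟩
      σ x + (emitted ρ N¹ x + ∑E² x)     ≡⟨ cong (σ x +_) (exchange x) ⟩
      σ x + (emitted ρ' N² x + ∑E¹ x)    ≡⟨ +-assoc (σ x) _ _ ⟨
      σ x + emitted ρ' N² x + ∑E¹ x      ≡⟨ cong (_+ ∑E¹ x) (balance N²-settles x Tx) ⟨
      N² x + ∑E¹ x                       ∎

    excess¹-avoids-t : ∑E¹ t ≡ 0
    excess¹-avoids-t = excess-avoids-targets T N¹ N² E¹ E² (idle N¹-settles)
      (λ u → ∑-sent (hd u) (ρ u) (N¹ u ∸ N² u)) balance-excess t Tt

    excess²-avoids-t : ∑E² t ≡ 0
    excess²-avoids-t = excess-avoids-targets T N² N¹ E² E¹ (idle N²-settles)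
      (λ u → ∑-sent (hd u) (ρ' u) (N² u ∸ N¹ u)) (λ x Tx → sym (balance-excess x Tx)) t Tt

  settles⇒supersolution : ∀ {ρ τ G} (σ : Particles) → Settles ρ (λ x → σ x + τ x) G → Supersolution ρ τ G
  settles⇒supersolution {τ = τ} σ G-settles x Tx =
    ≤-trans (m≤n+m _ (σ x)) (≤-reflexive (trans (sym (+-assoc (σ x) (τ x) _)) (sym (balance G-settles x Tx))))

  -- Abelian property: running σ and then walking a particle from v is the same as first
  -- walking it, which takes the least odometer M ≤ N + K, and then running σ.
  walk-before-run :
    ∀ {ρ ρa σ v} s t {N K M} → Settles ρ σ N → fire ρ N ≈ʳ ρa →
    Settles ρa (δ v) K → DeliversTo ρa K s →
    Settles ρ (δ v) M → Least ρ (δ v) M → DeliversTo ρ M t →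
    ∃ λ L → Settles (fire ρ M) σ L × fire (fire ρ M) L ≈ʳ fire ρa K ×
            (∀ t' → T t' ≡ true → δ t t' + emitted (fire ρ M) L t' ≡ emitted ρ N t' + δ s t')
  walk-before-run {ρ} {ρa} {σ} {v} s t {N} {K} {M} N-settles N-ends K-settles K-delivers M-settles M-least M-delivers =
    L , L-settles , L-ends , delivered
    where
    G L : Odometer
    G u = N u + K u
    G-settles : Settles ρ (λ x → σ x + δ v x) G
    G-settles = settles-+ N-settles N-ends K-settles
    M≤G : ∀ u → M u ≤ G u
    M≤G = M-least G (settles⇒supersolution σ G-settles)
    L u = G u ∸ M u
    G≡M+L : ∀ u → G u ≡ M u + L u
    G≡M+L u = sym (m+[n∸m]≡n (M≤G u))
    L-settles : Settles (fire ρ M) σ L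
    L-settles = settles-∸ {σ = σ} G-settles M-settles M≤G
    L-ends : fire (fire ρ M) L ≈ʳ fire ρa K
    L-ends u Tu = begin
      rotate (L u) (rotate (M u) (ρ u))  ≡⟨ rotate-+ (M u) (L u) (ρ u) ⟨
      rotate (M u + L u) (ρ u)           ≡⟨ cong (λ k → rotate k (ρ u)) (G≡M+L u) ⟨
      rotate (N u + K u) (ρ u)           ≡⟨ rotate-+ (N u) (K u) (ρ u) ⟩
      rotate (K u) (rotate (N u) (ρ u))  ≡⟨ cong (rotate (K u)) (N-ends u Tu) ⟩
      rotate (K u) (ρa u)                ∎
      where open ≡-Reasoning
    delivered : ∀ t' → T t' ≡ true → δ t t' + emitted (fire ρ M) L t' ≡ emitted ρ N t' + δ s t'
    delivered t' Tt' = begin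
      δ t t' + emitted (fire ρ M) L t'             ≡⟨ cong (_+ emitted (fire ρ M) L t') (M-delivers t' Tt') ⟨
      emitted ρ M t' + emitted (fire ρ M) L t'     ≡⟨ emitted-+ ρ M L (idle L-settles) (λ _ _ → refl) t' ⟨
      emitted ρ (λ u → M u + L u) t'               ≡⟨ emitted-cong ρ G≡M+L t' ⟨
      emitted ρ G t'                               ≡⟨ emitted-+ ρ N K (idle K-settles) N-ends t' ⟩
      emitted ρ N t' + emitted ρa K t'             ≡⟨ cong (emitted ρ N t' +_) (K-delivers t' Tt') ⟩
      emitted ρ N t' + δ s t'                      ∎
      where open ≡-Reasoning

  walk-target-≡ : ∀ {σ ρ₁ ρ₂ ρa ρb v t₁ t₂ s} → Run σ ρ₁ ρa → Run σ ρ₂ ρb → ρa ≈ʳ ρb →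
                  T v ≡ false → Walk ρ₁ v t₁ → Walk ρ₂ v t₂ → Walk ρa v s → t₁ ≡ t₂
  walk-target-≡ {t₁ = t₁} {t₂} {s} run₁ run₂ ρa≈ρb Tv walk₁ walk₂ walkₐ
    with run-odometer run₁ | run-odometer run₂ | walk-odometer walkₐ Tv
       | walk-odometer walk₁ Tv | walk-odometer walk₂ Tv
  ... | N₁ , N₁-settles , _ , N₁-ends | N₂ , N₂-settles , _ , N₂-ends | _ , K , K-settles , _ , K-delivers
      | Tt₁ , M₁ , M₁-settles , M₁-least , M₁-delivers | _ , M₂ , M₂-settles , M₂-least , M₂-delivers
    with walk-before-run s t₁ N₁-settles N₁-ends K-settles K-delivers M₁-settles M₁-least M₁-delivers
       | walk-before-run s t₂ N₂-settles (≈ʳ-trans N₂-ends (≈ʳ-sym ρa≈ρb)) K-settles K-delivers M₂-settles M₂-least M₂-delivers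
  ... | L₁ , L₁-settles , L₁-ends , delivered₁ | L₂ , L₂-settles , L₂-ends , delivered₂ =
    sym (δ≡1⇒≡ (+-cancelʳ-≡ _ (δ t₂ t₁) 1 (begin
      δ t₂ t₁ + eL₁                  ≡⟨ cong (δ t₂ t₁ +_) same-L ⟩
      δ t₂ t₁ + eL₂                  ≡⟨ delivered₂ t₁ Tt₁ ⟩
      eN₂ + δ s t₁                   ≡⟨ cong (_+ δ s t₁) same-N ⟨
      eN₁ + δ s t₁                   ≡⟨ delivered₁ t₁ Tt₁ ⟨
      δ t₁ t₁ + eL₁                  ≡⟨ cong (_+ eL₁) (δ-refl t₁) ⟩
      1 + eL₁                        ∎)))
    where
    open ≡-Reasoning
    eN₁ = emitted _ N₁ t₁
    eN₂ = emitted _ N₂ t₁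
    eL₁ = emitted _ L₁ t₁
    eL₂ = emitted _ L₂ t₁
    same-N : eN₁ ≡ eN₂
    same-N = delivered-unique N₁-settles N₂-settles (≈ʳ-trans N₁-ends (≈ʳ-trans ρa≈ρb (≈ʳ-sym N₂-ends))) t₁ Tt₁
    same-L : eL₁ ≡ eL₂
    same-L = delivered-unique L₁-settles L₂-settles (≈ʳ-trans L₁-ends (≈ʳ-sym L₂-ends)) t₁ Tt₁

  -- Termination of walks

  emitted-δ : ∀ ρ p → T p ≡ false → ∀ x → emitted ρ (δ p) x ≡ δ (nextVertex ρ p) x
  emitted-δ ρ p Tp x = begin
    emitted ρ (δ p) x                           ≡⟨ emitted-cong ρ (λ u → sym (+-identityʳ (δ p u))) x ⟩
    emitted ρ (λ u → δ p u + 0) x               ≡⟨ emitted-step (λ _ → 0) x ⟩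
    δ (nextVertex ρ p) x + emitted ρ⁺ (λ _ → 0) x ≡⟨ cong (δ (nextVertex ρ p) x +_) (emitted-zero ρ⁺ x) ⟩
    δ (nextVertex ρ p) x + 0                    ≡⟨ +-identityʳ _ ⟩
    δ (nextVertex ρ p) x                        ∎
    where
    open ≡-Reasoning
    open Step ρ p Tp using (ρ⁺; emitted-step)

  -- F is the odometer of the walk from v so far; the particle now sits at p ∉ T.
  record InFlight (ρ : RotorConfig) (v p : Fin n) (F : Odometer) : Set where
    field
      idle-on-T : IdleOnTargets F
      at-interior : T p ≡ false
      conservation : ∀ x → T x ≡ false → F x + δ p x ≡ δ v x + emitted ρ F x
      undelivered : ∀ t → T t ≡ true → emitted ρ F t ≡ 0

  module _ {ρ v p F} (flight : InFlight ρ v p F) where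
    open InFlight flight

    in-flight-emitted-≤ : ∀ y → emitted ρ F y ≤ F y + 1
    in-flight-emitted-≤ y with T y in Ty
    ... | true = ≤-trans (≤-reflexive (undelivered y Ty)) z≤n
    ... | false = begin
      emitted ρ F y           ≤⟨ m≤n+m _ (δ v y) ⟩
      δ v y + emitted ρ F y   ≡⟨ conservation y Ty ⟨
      F y + δ p y             ≤⟨ +-monoʳ-≤ (F y) (δ≤1 p y) ⟩
      F y + 1                 ∎
      where open ≤-Reasoning

    -- If x fired more than (c + 2) d(x) times, every arc out of x carried at least c + 2 particles.
    in-flight-arc-bound : ∀ x i c → F (hd x i) ≤ c → F x ≤ (c + 2) * d x
    in-flight-arc-bound x i c F-head≤c with F x ≤? (c + 2) * d x
    ... | yes F≤ = F≤
    ... | no F≰ = contradiction (begin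
      c + 2                                ≤⟨ sent-≥ (hd x) (c + 2) (F x) (ρ x) i (<⇒≤ (≰⇒> F≰)) ⟩
      sent (hd x) (ρ x) (F x) (hd x i)     ≤⟨ ∑-≤ (λ u → sent (hd u) (ρ u) (F u) (hd x i)) x ⟩
      emitted ρ F (hd x i)                 ≤⟨ in-flight-emitted-≤ (hd x i) ⟩
      F (hd x i) + 1                       ≤⟨ +-monoˡ-≤ 1 F-head≤c ⟩
      c + 1                                ∎) (<⇒≱ (+-monoʳ-< c (n<1+n 1)))
      where open ≤-Reasoning

  reach-bound : ∀ {x y} → Reach x y → ℕ → ℕ
  reach-bound here c = c
  reach-bound (there {v} r i) c = reach-bound r ((c + 2) * d v)

  in-flight-reach-bound : ∀ {ρ v p F} → InFlight ρ v p F → ∀ {x y} (r : Reach x y) c → F y ≤ c → F x ≤ reach-bound r c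
  in-flight-reach-bound flight here c F≤c = F≤c
  in-flight-reach-bound flight (there {w} r i) c F≤c =
    in-flight-reach-bound flight r ((c + 2) * d w) (in-flight-arc-bound flight w i c F≤c)

  in-flight-step : ∀ {ρ v p F ρc} → InFlight ρ v p F → ρc ≈ʳ fire ρ F → T (nextVertex ρc p) ≡ false →
                   InFlight ρ v (nextVertex ρc p) (λ u → F u + δ p u)
  in-flight-step {ρ} {v} {p} {F} {ρc} flight ρc≈ Tw = record
    { idle-on-T = λ t Tt → cong₂ _+_ (idle-on-T t Tt) (δ-≢ (T-true≢false Tt at-interior ∘ sym))
    ; at-interior = Tw
    ; conservation = λ x Tx → begin
        F x + δ p x + δ w x                  ≡⟨ cong (_+ δ w x) (conservation x Tx) ⟩
        δ v x + emitted ρ F x + δ w x        ≡⟨ +-assoc (δ v x) _ _ ⟩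
        δ v x + (emitted ρ F x + δ w x)      ≡⟨ cong (δ v x +_) (emitted-F⁺ x) ⟨
        δ v x + emitted ρ F⁺ x               ∎
    ; undelivered = λ t Tt → trans (emitted-F⁺ t) (cong₂ _+_ (undelivered t Tt) (δ-≢ (T-true≢false Tt Tw ∘ sym)))
    }
    where
    open ≡-Reasoning
    open InFlight flight
    w = nextVertex ρc p
    F⁺ : Odometer
    F⁺ u = F u + δ p u
    emitted-F⁺ : ∀ x → emitted ρ F⁺ x ≡ emitted ρ F x + δ w x
    emitted-F⁺ x = begin
      emitted ρ F⁺ x                                ≡⟨ emitted-+ ρ F (δ p) (λ t Tt → δ-≢ (T-true≢false Tt at-interior ∘ sym)) (λ _ _ → refl) x ⟩
      emitted ρ F x + emitted (fire ρ F) (δ p) x    ≡⟨ cong (emitted ρ F x +_) (emitted-δ (fire ρ F) p at-interior x) ⟩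
      emitted ρ F x + δ (nextVertex (fire ρ F) p) x ≡⟨ cong (λ r → emitted ρ F x + δ (hd p (cyc r)) x) (ρc≈ p at-interior) ⟨
      emitted ρ F x + δ w x                         ∎

  advance-≈ʳ-fire : ∀ {ρ ρc F} p → ρc ≈ʳ fire ρ F → advance ρc p ≈ʳ fire ρ (λ u → F u + δ p u)
  advance-≈ʳ-fire {ρ} {ρc} {F} p ρc≈ u Tu with p ≟ u
  ... | yes refl = trans (advance-self ρc p) (trans (cong cyc (ρc≈ p Tu)) (sym (rotate-+ (F p) 1 (ρ p))))
  ... | no p≢u = trans (advance-other ρc p≢u) (trans (ρc≈ u Tu) (cong (λ k → rotate k (ρ u)) (sym (+-identityʳ (F u)))))

  walk-terminates : StronglyConnected → ∀ {t₀} → T t₀ ≡ true → ∀ ρ v → T v ≡ false → ∃ λ t → Walk ρ v t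
  walk-terminates sc {t₀} Tt₀ ρ v Tv = walk-from (suc B) start (λ _ _ → refl) (≤-reflexive (cong (_+ suc B) (sym (∑-zero n))))
    where
    B : ℕ
    B = ∑[ x < n ] reach-bound (sc x t₀) 0

    total-≤ : ∀ {p F} → InFlight ρ v p F → sum F ≤ B
    total-≤ flight = ∑-mono-≤ {n} λ x →
      in-flight-reach-bound flight (sc x t₀) 0 (≤-reflexive (InFlight.idle-on-T flight t₀ Tt₀))

    start : InFlight ρ v v (λ _ → 0)
    start = record
      { idle-on-T = λ _ _ → refl
      ; at-interior = Tv
      ; conservation = λ x _ → sym (trans (cong (δ v x +_) (emitted-zero ρ x)) (+-identityʳ (δ v x)))
      ; undelivered = λ t _ → emitted-zero ρ t
      }

    -- Each step raises the total firing count by one, and it never exceeds B.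
    walk-from : ∀ fuel {p F ρc} → InFlight ρ v p F → ρc ≈ʳ fire ρ F → B < sum F + fuel → ∃ λ t → Walk ρc p t
    walk-from zero flight ρc≈ B< = contradiction (total-≤ flight) (<⇒≱ (subst (B <_) (+-identityʳ _) B<))
    walk-from (suc fuel) {p} {F} {ρc} flight ρc≈ B< with T (nextVertex ρc p) in Tw
    ... | true = _ , stop Tw
    ... | false with walk-from fuel (in-flight-step flight ρc≈ Tw) (advance-≈ʳ-fire {ρ} {ρc} {F} p ρc≈) B<′
      where
      B<′ : B < sum (λ u → F u + δ p u) + fuel
      B<′ = subst (B <_) (begin
        sum F + suc fuel          ≡⟨ +-suc (sum F) fuel ⟩
        suc (sum F + fuel)        ≡⟨ cong (_+ fuel) (trans (cong (sum F +_) (∑-δ p)) (+-comm (sum F) 1)) ⟨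
        sum F + ∑[ u < n ] δ p u + fuel ≡⟨ cong (_+ fuel) (∑-distrib-+ {n} F (δ p)) ⟨
        sum (λ u → F u + δ p u) + fuel ∎) B<
        where open ≡-Reasoning
    ...   | t , walk = t , go Tw walk

lemma3p10 : (n : ℕ) (d : Fin n → ℕ) (hd : (v : Fin n) → Fin (d v) → Fin n)
    (T : Fin n → Bool) →
    Rotor.StronglyConnected n d hd T →
    Σ (Fin n) (λ t → T t ≡ true) →
    (ρ₁ ρ₂ : Rotor.RotorConfig n d hd T) →
    Rotor.Equiv n d hd T ρ₁ ρ₂ →
    (v : Fin n) → T v ≡ false →
    Σ (Fin n) (λ t → Rotor.Walk n d hd T ρ₁ v t × Rotor.Walk n d hd T ρ₂ v t)
lemma3p10 n d hd T sc (_ , Tt₀) ρ₁ ρ₂ (_ , ρa , ρb , run₁ , run₂ , ρa≈ρb) v Tv =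
  let t₁ , walk₁ = walk-terminates sc Tt₀ ρ₁ v Tv
      _ , walk₂ = walk-terminates sc Tt₀ ρ₂ v Tv
      _ , walkₐ = walk-terminates sc Tt₀ ρa v Tv
  in t₁ , walk₁ , subst (Walk ρ₂ v) (sym (walk-target-≡ run₁ run₂ ρa≈ρb Tv walk₁ walk₂ walkₐ)) walk₂
  where
  open Rotor n d hd T
  open RotorWalks n d hd T
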